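{- Let $\alpha\in\{U,\ UU,\ UD,\ UF,\ DU,\ FU\}$ and $n\geq 0$. The number of $\alpha$-equivalence classes of the set $\mathcal{L}_n$ of Łukasiewicz paths of length $n$ equals the number of $\alpha$-equivalence classes of the set $\mathcal{M}_n$ of Motzkin paths of length $n$.
   Context: A lattice path of length $n$ is a sequence of $n$ steps from $\{(1,i): i\in\mathbb{Z}\}$ starting at $(0,0)$, ending at $(n,0)$ and never going below the $x$-axis. Write $D=(1,-1)$, $F=(1,0)$, $U=U_1=(1,1)$ and $U_i=(1,i)$ for $i\geq 2$. A Łukasiewicz path is a lattice path with steps in $\{(1,i): i\geq -1\}$; a Motzkin path is a lattice path with steps in $\{U,F,D\}$. $\mathcal{L}_n$ and $\mathcal{M}_n$ denote the sets of Łukasiewicz, resp. Motzkin, paths of length $n$. Steps are numbered $1,\dots,n$; an occurrence of a pattern (one step, or two consecutive steps) is at position $i$ if its first step is the $i$-th step. Two paths of the same length are $\alpha$-equivalent if the sets of occurrence positions of $\alpha$ in them are identical; on $\mathcal{M}_n$ the same relation is used (restricted to $\mathcal{M}_n$). -}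

module Defs where

open import Data.Nat using (ℕ; zero; suc; _+_; _∸_; _≤_)
open import Data.List using (List; []; _∷_; length; take; drop)
open import Data.List.Relation.Unary.All using (All)
open import Data.Fin using (Fin)
open import Data.Product using (Σ; ∃; _×_)
open import Relation.Binary.PropositionalEquality using (_≡_)
open import Relation.Nullary using (¬_)
open import Function.Bundles using (_⇔_)

-- Steps (1,i), i ≥ -1.
--   D     = (1,-1)
--   F     = (1, 0)
--   Up i  = (1, i+1)   so  Up 0 = U = U₁ = (1,1),  Up 1 = U₂, ...
data Step : Set where
  D  : Step
  F  : Step
  Up : ℕ → Step

U : Step
U = Up 0

-- Valid h s : the step sequence s, started at height h, never goes
-- below the x-axis and ends at height 0.
data Valid : ℕ → List Step → Set where
  nil : Valid 0 []
  dn  : ∀ {h s} → Valid h s → Valid (suc h) (D ∷ s)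
  fl  : ∀ {h s} → Valid h s → Valid h (F ∷ s)
  up  : ∀ {h i s} → Valid (suc i + h) s → Valid h (Up i ∷ s)

IsLuk : ℕ → List Step → Set
IsLuk n s = length s ≡ n × Valid 0 s

data IsMotzStep : Step → Set where
  mU : IsMotzStep U
  mF : IsMotzStep F
  mD : IsMotzStep D

IsMotz : ℕ → List Step → Set
IsMotz n s = IsLuk n s × All IsMotzStep s

data Pattern : Set where
  pU pUU pUD pUF pDU pFU : Pattern

word : Pattern → List Step
word pU  = U ∷ []
word pUU = U ∷ U ∷ []
word pUD = U ∷ D ∷ []
word pUF = U ∷ F ∷ []
word pDU = D ∷ U ∷ []
word pFU = F ∷ U ∷ []

-- α occurs at position i (steps numbered 1..n) of s: its first step is
-- the i-th step of s.
Occurs : Pattern → ℕ → List Step → Set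
Occurs α i s = 1 ≤ i × take (length (word α)) (drop (i ∸ 1) s) ≡ word α

AlphaEquiv : Pattern → List Step → List Step → Set
AlphaEquiv α s t = ∀ i → Occurs α i s ⇔ Occurs α i t

HasNumClasses : {A : Set} → (A → Set) → (A → A → Set) → ℕ → Set
HasNumClasses {A} P _~_ k =
  Σ (Fin k → A) λ rep →
    (∀ j → P (rep j)) ×
    (∀ j j′ → rep j ~ rep j′ → j ≡ j′) ×
    (∀ x → P x → ∃ λ j → x ~ rep j)

-- Every Łukasiewicz path s is α-equivalent to a Motzkin path t of the same
-- length.  For α ∈ {U, UU, UD, UF, FU}, t copies the occurrences of α (or the
-- U steps, for UU) and replaces every other step by D when t is above the
-- axis and by F on it; t then never rises above s, so it ends on the axis.
-- For DU, t climbs to height 1 just before the first occurrence, meets every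
-- occurrence as a DU on that plateau, and descends right after the last one.
-- Since Motzkin paths are Łukasiewicz paths, both sets meet exactly the same
-- α-classes.  These are counted among the finitely many Motzkin words of
-- length n, on which α-equivalence is decided by comparing occurrence vectors.
module Submission where

open import Defs
open import Data.Bool using (Bool; true; false; _∧_)
import Data.Bool as Bool
open import Data.Bool.Properties using (∧-identityʳ; ∨-conicalˡ; ∨-conicalʳ)
open import Data.Empty using (⊥-elim)
open import Data.Fin using (Fin; zero; suc)
open import Data.Fin.Properties using (any?)
open import Data.List using (List; []; _∷_; length; take; drop; map; _++_; cartesianProductWith)
open import Data.Bool.ListAction using (or)
open import Data.List.Properties using (≡-dec; ∷-injectiveˡ; ∷-injectiveʳ; take++drop≡id)
open import Data.List.Membership.Propositional using (_∈_)
open import Data.List.Membership.Propositional.Properties using (∈-cartesianProductWith⁺)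
open import Data.List.Relation.Unary.All using (All; []; _∷_; all?)
open import Data.List.Relation.Unary.Any using (here; there)
open import Data.List.Relation.Binary.Pointwise using (Pointwise; []; _∷_; Pointwise-length)
open import Data.Nat using (ℕ; zero; suc; pred; _≤_; z≤n; s≤s)
import Data.Nat as ℕ
open import Data.Nat.Properties using (suc-injective; ≤-refl; ≤-trans; pred-mono-≤; pred[n]≤n; m≤n+m)
open import Data.Product using (∃; _×_; _,_; proj₁; proj₂)
open import Data.Sum using (_⊎_; inj₁; inj₂)
open import Function using (_∘_)
open import Function.Bundles using (_⇔_; mk⇔; Equivalence)
open import Function.Properties.Equivalence using (⇔-isEquivalence)
open import Relation.Binary.Definitions using (DecidableEquality)
open import Relation.Binary.Structures using (IsEquivalence)
open import Relation.Binary.PropositionalEquality using (_≡_; refl; sym; trans; cong; cong₂; subst)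
open import Relation.Nullary using (Dec; yes; no; does)
open import Relation.Nullary.Decidable using (map′; dec-false; _×-dec_)
import Relation.Nullary.Decidable as Dec
open import Relation.Unary using (Decidable)

private
  module ⇔ {ℓ} = IsEquivalence (⇔-isEquivalence {ℓ})

Up-injective : ∀ {i j} → Up i ≡ Up j → i ≡ j
Up-injective refl = refl

_≟ₛ_ : DecidableEquality Step
D    ≟ₛ D    = yes refl
F    ≟ₛ F    = yes refl
Up i ≟ₛ Up j = map′ (cong Up) Up-injective (i ℕ.≟ j)
D    ≟ₛ F    = no λ ()
D    ≟ₛ Up _ = no λ ()
F    ≟ₛ D    = no λ ()
F    ≟ₛ Up _ = no λ ()
Up _ ≟ₛ D    = no λ ()
Up _ ≟ₛ F    = no λ ()

Starts : Pattern → List Step → Set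
Starts α l = take (length (word α)) l ≡ word α

starts? : ∀ α l → Dec (Starts α l)
starts? α l = ≡-dec _≟ₛ_ (take (length (word α)) l) (word α)

startsWith : Pattern → List Step → Bool
startsWith α l = does (starts? α l)

occ : Pattern → List Step → List Bool
occ α []      = []
occ α (x ∷ s) = startsWith α (x ∷ s) ∷ occ α s

does-≡⇔ : ∀ {A B : Set} (a? : Dec A) (b? : Dec B) → does a? ≡ does b? ⇔ (A ⇔ B)
does-≡⇔ a? b? = mk⇔ (to a? b?) (from a? b?)
  where
  to : ∀ {A B : Set} (a? : Dec A) (b? : Dec B) → does a? ≡ does b? → A ⇔ B
  to (yes a) (yes b) _ = mk⇔ (λ _ → b) (λ _ → a)
  to (no ¬a) (no ¬b) _ = mk⇔ (⊥-elim ∘ ¬a) (⊥-elim ∘ ¬b)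
  to (yes _) (no _) ()
  to (no _) (yes _) ()
  from : ∀ {A B : Set} (a? : Dec A) (b? : Dec B) → A ⇔ B → does a? ≡ does b?
  from (yes _) (yes _) _   = refl
  from (no _)  (no _)  _   = refl
  from (yes a) (no ¬b) a⇔b = ⊥-elim (¬b (Equivalence.to a⇔b a))
  from (no ¬a) (yes b) a⇔b = ⊥-elim (¬a (Equivalence.from a⇔b b))

module _ {α : Pattern} where

  alphaEquiv-refl : ∀ {s} → AlphaEquiv α s s
  alphaEquiv-refl _ = ⇔.refl

  alphaEquiv-sym : ∀ {s t} → AlphaEquiv α s t → AlphaEquiv α t s
  alphaEquiv-sym s~t i = ⇔.sym (s~t i)

  alphaEquiv-trans : ∀ {s t u} → AlphaEquiv α s t → AlphaEquiv α t u → AlphaEquiv α s u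
  alphaEquiv-trans s~t t~u i = ⇔.trans (s~t i) (t~u i)

  alphaEquiv⇔startsWith-drop : ∀ {s t} →
    AlphaEquiv α s t ⇔ (∀ j → startsWith α (drop j s) ≡ startsWith α (drop j t))
  alphaEquiv⇔startsWith-drop {s} {t} = mk⇔ to from
    where
    occurs-suc : ∀ {j u} → Occurs α (suc j) u ⇔ Starts α (drop j u)
    occurs-suc = mk⇔ proj₂ (s≤s z≤n ,_)
    to : AlphaEquiv α s t → ∀ j → startsWith α (drop j s) ≡ startsWith α (drop j t)
    to s~t j = Equivalence.from (does-≡⇔ (starts? α _) (starts? α _))
      (⇔.trans (⇔.sym occurs-suc) (⇔.trans (s~t (suc j)) occurs-suc))
    from : (∀ j → startsWith α (drop j s) ≡ startsWith α (drop j t)) → AlphaEquiv α s t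
    from _ zero = mk⇔ (λ { (() , _) }) (λ { (() , _) })
    from same (suc j) = ⇔.trans occurs-suc
      (⇔.trans (Equivalence.to (does-≡⇔ (starts? α _) (starts? α _)) (same j)) (⇔.sym occurs-suc))

  occ≡⇔startsWith-drop : ∀ {s t} → length s ≡ length t →
    occ α s ≡ occ α t ⇔ (∀ j → startsWith α (drop j s) ≡ startsWith α (drop j t))
  occ≡⇔startsWith-drop {s} {t} len = mk⇔ (to s t) (from s t len)
    where
    to : ∀ s t → occ α s ≡ occ α t → ∀ j → startsWith α (drop j s) ≡ startsWith α (drop j t)
    to []      []      _ _       = refl
    to (_ ∷ _) (_ ∷ _) e zero    = ∷-injectiveˡ e
    to (_ ∷ s) (_ ∷ t) e (suc j) = to s t (∷-injectiveʳ e) j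
    from : ∀ s t → length s ≡ length t →
      (∀ j → startsWith α (drop j s) ≡ startsWith α (drop j t)) → occ α s ≡ occ α t
    from []      []      _   _    = refl
    from (_ ∷ s) (_ ∷ t) len same = cong₂ _∷_ (same zero) (from s t (suc-injective len) (same ∘ suc))

  alphaEquiv⇔occ≡ : ∀ {s t} → length s ≡ length t → AlphaEquiv α s t ⇔ occ α s ≡ occ α t
  alphaEquiv⇔occ≡ len = ⇔.trans alphaEquiv⇔startsWith-drop (⇔.sym (occ≡⇔startsWith-drop len))

data StartsView (α : Pattern) : List Step → Set where
  end   : StartsView α []
  block : ∀ s → StartsView α (word α ++ s)
  skip  : ∀ x s → startsWith α (x ∷ s) ≡ false → StartsView α (x ∷ s)

startsView : ∀ α s → StartsView α s
startsView α []      = end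
startsView α (x ∷ s) with starts? α (x ∷ s)
... | yes p = subst (StartsView α) (trans (cong (_++ rest) (sym p)) (take++drop≡id k (x ∷ s))) (block rest)
  where
  k = length (word α)
  rest = drop k (x ∷ s)
... | no ¬p = skip x s (dec-false (starts? α (x ∷ s)) ¬p)

valid-∷⁻ : ∀ {h x s} → Valid h (x ∷ s) → ∃ λ h′ → pred h ≤ h′ × Valid h′ s
valid-∷⁻ (dn v)         = _ , ≤-refl , v
valid-∷⁻ (fl v)         = _ , pred[n]≤n , v
valid-∷⁻ (up {i = i} v) = _ , ≤-trans pred[n]≤n (m≤n+m _ (suc i)) , v

lower : ℕ → Step
lower zero    = F
lower (suc _) = D

-- The index m is the current height of t.
data Lowering : ℕ → List Step → List Step → Set where
  []     : ∀ {m} → Lowering m [] []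
  keepU  : ∀ {m s t} → Lowering (suc m) s t → Lowering m (U ∷ s) (U ∷ t)
  keepF  : ∀ {m s t} → Lowering m s t → Lowering m (F ∷ s) (F ∷ t)
  lower∷ : ∀ {m x s t} → Lowering (pred m) s t → Lowering m (x ∷ s) (lower m ∷ t)

-- Every step of s lowers the height by at most one, so t stays below s.
Lowering-valid : ∀ {m h s t} → Lowering m s t → Valid h s → m ≤ h → Valid m t
Lowering-valid []        nil    z≤n = nil
Lowering-valid (keepU l) (up v) m≤h = up (Lowering-valid l v (s≤s m≤h))
Lowering-valid (keepF l) (fl v) m≤h = fl (Lowering-valid l v m≤h)
Lowering-valid {m} (lower∷ l) v m≤h with valid-∷⁻ v
... | _ , h-1≤h′ , v′ = lower-valid m (Lowering-valid l v′ (≤-trans (pred-mono-≤ m≤h) h-1≤h′))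
  where
  lower-valid : ∀ {t} m → Valid (pred m) t → Valid m (lower m ∷ t)
  lower-valid zero    = fl
  lower-valid (suc _) = dn

Motzkinisation : List Step → List Step → Set
Motzkinisation = Pointwise (λ _ → IsMotzStep)

Lowering-motzkin : ∀ {m s t} → Lowering m s t → Motzkinisation s t
Lowering-motzkin []        = []
Lowering-motzkin (keepU l) = mU ∷ Lowering-motzkin l
Lowering-motzkin (keepF l) = mF ∷ Lowering-motzkin l
Lowering-motzkin {m} (lower∷ l) = lower-motzkin m ∷ Lowering-motzkin l
  where
  lower-motzkin : ∀ m → IsMotzStep (lower m)
  lower-motzkin zero    = mF
  lower-motzkin (suc _) = mD

startsWith-lower : ∀ α → (∀ t → startsWith α (F ∷ t) ≡ false) → (∀ t → startsWith α (D ∷ t) ≡ false) →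
  ∀ m t → startsWith α (lower m ∷ t) ≡ false
startsWith-lower α notF notD zero    = notF
startsWith-lower α notF notD (suc _) = notD

isU : Step → Bool
isU x = does (x ≟ₛ U)

occ-pU-isU : ∀ {s t} → map isU s ≡ map isU t → occ pU s ≡ occ pU t
occ-pU-isU {[]}    {[]}    _ = refl
occ-pU-isU {x ∷ s} {y ∷ t} e =
  cong₂ _∷_ (cong (_∧ true) {isU x} {isU y} (∷-injectiveˡ e)) (occ-pU-isU {s} {t} (∷-injectiveʳ e))

occ-pUU-isU : ∀ {s t} → map isU s ≡ map isU t → occ pUU s ≡ occ pUU t
occ-pUU-isU {[]}        {[]}        _ = refl
occ-pUU-isU {x ∷ []}    {y ∷ []}    e = cong (λ b → (b ∧ false) ∷ []) {isU x} {isU y} (∷-injectiveˡ e)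
occ-pUU-isU {x ∷ x′ ∷ s} {y ∷ y′ ∷ t} e = cong₂ _∷_
  (cong₂ (λ a b → a ∧ (b ∧ true)) {isU x} {isU y} {isU x′} {isU y′}
         (∷-injectiveˡ e) (∷-injectiveˡ (∷-injectiveʳ e)))
  (occ-pUU-isU {x′ ∷ s} {y′ ∷ t} (∷-injectiveʳ e))

shadowU : ℕ → List Step → List Step
shadowU m s with startsView pU s
... | end         = []
... | block s′    = U ∷ shadowU (suc m) s′
... | skip _ s′ _ = lower m ∷ shadowU (pred m) s′

shadowU-lowering : ∀ m s → Lowering m s (shadowU m s)
shadowU-lowering m s with startsView pU s
... | end         = []
... | block s′    = keepU (shadowU-lowering (suc m) s′)
... | skip _ s′ _ = lower∷ (shadowU-lowering (pred m) s′)

shadowU-isU : ∀ m s → map isU (shadowU m s) ≡ map isU s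
shadowU-isU m s with startsView pU s
... | end         = refl
... | block s′    = cong (true ∷_) (shadowU-isU (suc m) s′)
... | skip x s′ e = cong₂ _∷_ (trans (isU-lower m) (sym x-not-U)) (shadowU-isU (pred m) s′)
  where
  x-not-U : isU x ≡ false
  x-not-U = trans (sym (∧-identityʳ (isU x))) e
  isU-lower : ∀ m → isU (lower m) ≡ false
  isU-lower zero    = refl
  isU-lower (suc _) = refl

shadowUD : List Step → List Step
shadowUD s with startsView pUD s
... | end         = []
... | block s′    = U ∷ D ∷ shadowUD s′
... | skip _ s′ _ = F ∷ shadowUD s′

shadowUD-lowering : ∀ s → Lowering 0 s (shadowUD s)
shadowUD-lowering s with startsView pUD s
... | end         = []
... | block s′    = keepU (lower∷ (shadowUD-lowering s′))
... | skip _ s′ _ = lower∷ (shadowUD-lowering s′)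

occ-shadowUD : ∀ s → occ pUD (shadowUD s) ≡ occ pUD s
occ-shadowUD s with startsView pUD s
... | end         = refl
... | block s′    = cong (λ o → true ∷ false ∷ o) (occ-shadowUD s′)
... | skip _ s′ e = cong₂ _∷_ (sym e) (occ-shadowUD s′)

shadowUF : ℕ → List Step → List Step
shadowUF m s with startsView pUF s
... | end         = []
... | block s′    = U ∷ F ∷ shadowUF (suc m) s′
... | skip _ s′ _ = lower m ∷ shadowUF (pred m) s′

shadowUF-lowering : ∀ m s → Lowering m s (shadowUF m s)
shadowUF-lowering m s with startsView pUF s
... | end         = []
... | block s′    = keepU (keepF (shadowUF-lowering (suc m) s′))
... | skip _ s′ _ = lower∷ (shadowUF-lowering (pred m) s′)

occ-shadowUF : ∀ m s → occ pUF (shadowUF m s) ≡ occ pUF s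
occ-shadowUF m s with startsView pUF s
... | end         = refl
... | block s′    = cong (λ o → true ∷ false ∷ o) (occ-shadowUF (suc m) s′)
... | skip _ s′ e = cong₂ _∷_ (trans lowered (sym e)) (occ-shadowUF (pred m) s′)
  where
  lowered : startsWith pUF (lower m ∷ shadowUF (pred m) s′) ≡ false
  lowered = startsWith-lower pUF (λ _ → refl) (λ _ → refl) m (shadowUF (pred m) s′)

shadowFU : ℕ → List Step → List Step
shadowFU m s with startsView pFU s
... | end         = []
... | block s′    = F ∷ U ∷ shadowFU (suc m) s′
... | skip _ s′ _ = lower m ∷ shadowFU (pred m) s′

shadowFU-lowering : ∀ m s → Lowering m s (shadowFU m s)
shadowFU-lowering m s with startsView pFU s
... | end         = []
... | block s′    = keepF (keepU (shadowFU-lowering (suc m) s′))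
... | skip _ s′ _ = lower∷ (shadowFU-lowering (pred m) s′)

shadowFU-startsWith-U : ∀ m s → startsWith pU (shadowFU m s) ≡ false
shadowFU-startsWith-U m s with startsView pFU s
... | end         = refl
... | block _     = refl
... | skip _ s′ _ = startsWith-lower pU (λ _ → refl) (λ _ → refl) m (shadowFU (pred m) s′)

occ-shadowFU : ∀ m s → occ pFU (shadowFU m s) ≡ occ pFU s
occ-shadowFU m s with startsView pFU s
... | end         = refl
... | block s′    = cong (λ o → true ∷ false ∷ o) (occ-shadowFU (suc m) s′)
... | skip _ s′ e = cong₂ _∷_ (trans (lowered m) (sym e)) (occ-shadowFU (pred m) s′)
  where
  lowered : ∀ m → startsWith pFU (lower m ∷ shadowFU (pred m) s′) ≡ false
  lowered zero    = shadowFU-startsWith-U zero s′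
  lowered (suc _) = refl

hasDU : List Step → Bool
hasDU s = or (occ pDU s)

flats : List Step → List Step
flats = map (λ _ → F)

-- At height 1: meet each DU as D U, stay level while another DU lies ahead,
-- and otherwise step down to the axis for good.
plateauDU : List Step → List Step
plateauDU s with startsView pDU s
... | end         = []
... | block s′    = D ∷ U ∷ plateauDU s′
... | skip _ s′ _ with hasDU s′
...   | true  = F ∷ plateauDU s′
...   | false = D ∷ flats s′

-- At height 0: go up just before the first DU.
riseDU : List Step → List Step
riseDU []      = []
riseDU (_ ∷ s) with startsView pDU s
... | end         = F ∷ []
... | block s′    = U ∷ plateauDU (D ∷ U ∷ s′)
... | skip y s′ _ = F ∷ riseDU (y ∷ s′)

occ-flats : ∀ s → hasDU s ≡ false → occ pDU (flats s) ≡ occ pDU s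
occ-flats []      _    = refl
occ-flats (_ ∷ s) none = cong₂ _∷_ (sym (∨-conicalˡ _ _ none)) (occ-flats s (∨-conicalʳ _ _ none))

occ-plateauDU : ∀ s → occ pDU (plateauDU s) ≡ occ pDU s
occ-plateauDU s with startsView pDU s
... | end         = refl
... | block s′    = cong (λ o → true ∷ false ∷ o) (occ-plateauDU s′)
... | skip _ s′ e with hasDU s′ in ahead
...   | true  = cong₂ _∷_ (sym e) (occ-plateauDU s′)
...   | false = cong₂ _∷_ (trans (D-flats s′) (sym e)) (occ-flats s′ ahead)
  where
  D-flats : ∀ s → startsWith pDU (D ∷ flats s) ≡ false
  D-flats []      = refl
  D-flats (_ ∷ _) = refl

occ-riseDU : ∀ s → startsWith pDU s ≡ false → occ pDU (riseDU s) ≡ occ pDU s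
occ-riseDU []      _     = refl
occ-riseDU (_ ∷ s) noDU with startsView pDU s
... | end         = cong (_∷ []) (sym noDU)
... | block s′    = cong₂ _∷_ (sym noDU) (occ-plateauDU (D ∷ U ∷ s′))
... | skip y s′ e = cong₂ _∷_ (sym noDU) (occ-riseDU (y ∷ s′) e)

flats-valid : ∀ s → Valid 0 (flats s)
flats-valid []      = nil
flats-valid (_ ∷ s) = fl (flats-valid s)

plateauDU-valid : ∀ {h} s → Valid h s → 1 ≤ h ⊎ hasDU s ≡ true → Valid 1 (plateauDU s)
plateauDU-valid s v high with startsView pDU s
plateauDU-valid .[] nil (inj₁ ()) | end
plateauDU-valid .[] nil (inj₂ ()) | end
plateauDU-valid .(D ∷ U ∷ s′) (dn (up v)) _ | block s′ = dn (up (plateauDU-valid s′ v (inj₁ (s≤s z≤n))))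
plateauDU-valid .(x ∷ s′) v _ | skip x s′ _ with hasDU s′ in ahead
... | true  = let _ , _ , v′ = valid-∷⁻ v in fl (plateauDU-valid s′ v′ (inj₂ ahead))
... | false = dn (flats-valid s′)

riseDU-valid : ∀ {h} s → Valid h s → Valid 0 (riseDU s)
riseDU-valid []      _ = nil
riseDU-valid (_ ∷ s) v with startsView pDU s | valid-∷⁻ v
... | end         | _ = fl nil
... | block s′    | _ , _ , v′ = up (plateauDU-valid (D ∷ U ∷ s′) v′ (inj₂ refl))
... | skip y s′ _ | _ , _ , v′ = fl (riseDU-valid (y ∷ s′) v′)

flats-motzkin : ∀ s → Motzkinisation s (flats s)
flats-motzkin []      = []
flats-motzkin (_ ∷ s) = mF ∷ flats-motzkin s

plateauDU-motzkin : ∀ s → Motzkinisation s (plateauDU s)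
plateauDU-motzkin s with startsView pDU s
... | end         = []
... | block s′    = mD ∷ mU ∷ plateauDU-motzkin s′
... | skip _ s′ _ with hasDU s′
...   | true  = mF ∷ plateauDU-motzkin s′
...   | false = mD ∷ flats-motzkin s′

riseDU-motzkin : ∀ s → Motzkinisation s (riseDU s)
riseDU-motzkin []      = []
riseDU-motzkin (_ ∷ s) with startsView pDU s
... | end         = mF ∷ []
... | block s′    = mU ∷ plateauDU-motzkin (D ∷ U ∷ s′)
... | skip y s′ _ = mF ∷ riseDU-motzkin (y ∷ s′)

valid₀-startsWith-pDU : ∀ {s} → Valid 0 s → startsWith pDU s ≡ false
valid₀-startsWith-pDU nil    = refl
valid₀-startsWith-pDU (fl _) = refl
valid₀-startsWith-pDU (up _) = refl

twin-by-occ : ∀ {α n s t} → IsLuk n s → Motzkinisation s t → Valid 0 t → occ α t ≡ occ α s →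
  ∃ λ t → IsMotz n t × AlphaEquiv α s t
twin-by-occ {t = t} (len , _) st v same =
  t , ((trans (sym (Pointwise-length st)) len , v) , all-motzkin st) ,
  Equivalence.from (alphaEquiv⇔occ≡ (Pointwise-length st)) (sym same)
  where
  all-motzkin : ∀ {s t} → Motzkinisation s t → All IsMotzStep t
  all-motzkin []       = []
  all-motzkin (m ∷ st) = m ∷ all-motzkin st

twin-by-lowering : ∀ {α n s t} → IsLuk n s → Lowering 0 s t → occ α t ≡ occ α s →
  ∃ λ t → IsMotz n t × AlphaEquiv α s t
twin-by-lowering luk@(_ , v) l = twin-by-occ luk (Lowering-motzkin l) (Lowering-valid l v z≤n)

motzkinTwin : ∀ α {n s} → IsLuk n s → ∃ λ t → IsMotz n t × AlphaEquiv α s t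
motzkinTwin pU  luk = twin-by-lowering luk (shadowU-lowering 0 _) (occ-pU-isU (shadowU-isU 0 _))
motzkinTwin pUU luk = twin-by-lowering luk (shadowU-lowering 0 _) (occ-pUU-isU (shadowU-isU 0 _))
motzkinTwin pUD luk = twin-by-lowering luk (shadowUD-lowering _) (occ-shadowUD _)
motzkinTwin pUF luk = twin-by-lowering luk (shadowUF-lowering 0 _) (occ-shadowUF 0 _)
motzkinTwin pFU luk = twin-by-lowering luk (shadowFU-lowering 0 _) (occ-shadowFU 0 _)
motzkinTwin pDU {s = s} luk@(_ , v) =
  twin-by-occ luk (riseDU-motzkin s) (riseDU-valid s v) (occ-riseDU s (valid₀-startsWith-pDU v))

valid? : ∀ h s → Dec (Valid h s)
valid? zero    []          = yes nil
valid? (suc _) []          = no λ ()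
valid? zero    (D ∷ _)     = no λ ()
valid? (suc h) (D ∷ s)     = map′ dn (λ { (dn v) → v }) (valid? h s)
valid? h       (F ∷ s)     = map′ fl (λ { (fl v) → v }) (valid? h s)
valid? h       (Up i ∷ s)  = map′ up (λ { (up v) → v }) (valid? (suc i ℕ.+ h) s)

isMotzStep? : Decidable IsMotzStep
isMotzStep? D            = yes mD
isMotzStep? F            = yes mF
isMotzStep? (Up zero)    = yes mU
isMotzStep? (Up (suc _)) = no λ ()

isMotz? : ∀ n → Decidable (IsMotz n)
isMotz? n s = ((length s ℕ.≟ n) ×-dec valid? 0 s) ×-dec all? isMotzStep? s

alphaEquiv? : ∀ α {n s t} → IsMotz n s → IsMotz n t → Dec (AlphaEquiv α s t)
alphaEquiv? α ((ls , _) , _) ((lt , _) , _) =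
  Dec.map (⇔.sym (alphaEquiv⇔occ≡ (trans ls (sym lt)))) (≡-dec Bool._≟_ (occ α _) (occ α _))

motzkinWords : ℕ → List (List Step)
motzkinWords zero    = [] ∷ []
motzkinWords (suc n) = cartesianProductWith _∷_ (U ∷ F ∷ D ∷ []) (motzkinWords n)

∈-motzkinWords : ∀ {n s} → length s ≡ n → All IsMotzStep s → s ∈ motzkinWords n
∈-motzkinWords {zero}  {[]}    _   _        = here refl
∈-motzkinWords {suc n} {_ ∷ _} len (m ∷ ms) =
  ∈-cartesianProductWith⁺ _∷_ (step∈ m) (∈-motzkinWords (suc-injective len) ms)
  where
  step∈ : ∀ {x} → IsMotzStep x → x ∈ U ∷ F ∷ D ∷ []
  step∈ mU = here refl
  step∈ mF = there (here refl)
  step∈ mD = there (there (here refl))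

module _ {A : Set} {_~_ : A → A → Set} where

  hasNumClasses-transfer : ∀ {P Q : A → Set} {k} → (∀ {x y z} → x ~ y → y ~ z → x ~ z) →
    (∀ {x} → Q x → P x) → (∀ {x} → P x → ∃ λ y → Q y × x ~ y) →
    HasNumClasses Q _~_ k → HasNumClasses P _~_ k
  hasNumClasses-transfer ~-trans Q⇒P reach (rep , repQ , rep-inj , cover) =
    rep , Q⇒P ∘ repQ , rep-inj , λ x px →
      let y , qy , x~y = reach px
          j , y~rj     = cover y qy
      in j , ~-trans x~y y~rj

  module _ {P : A → Set} (~-refl : ∀ {x} → x ~ x) (~-sym : ∀ {x y} → x ~ y → y ~ x)
           (P? : Decidable P) (_~?_ : ∀ {x y} → P x → P y → Dec (x ~ y)) where

    classesIn : ∀ L → ∃ λ k → HasNumClasses (λ x → x ∈ L × P x) _~_ k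
    classesIn [] = 0 , (λ ()) , (λ ()) , (λ ()) , λ { _ (() , _) }
    classesIn (x ∷ L) with classesIn L
    ... | k , rep , rep∈ , rep-inj , cover = extend (P? x)
      where
      old∈ : ∀ j → rep j ∈ x ∷ L × P (rep j)
      old∈ j = there (proj₁ (rep∈ j)) , proj₂ (rep∈ j)

      coverWith : (∀ {y} → y ≡ x → P y → ∃ λ j → y ~ rep j) →
        ∀ y → y ∈ x ∷ L × P y → ∃ λ j → y ~ rep j
      coverWith new y (here y≡x  , py) = new y≡x py
      coverWith new y (there y∈L , py) = cover y (y∈L , py)

      extend : Dec (P x) → ∃ λ k′ → HasNumClasses (λ y → y ∈ x ∷ L × P y) _~_ k′
      extend (no ¬px) = k , rep , old∈ , rep-inj , coverWith λ { refl px → ⊥-elim (¬px px) }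
      extend (yes px) with any? (λ j → px ~? proj₂ (rep∈ j))
      ... | yes (j , x~rj) = k , rep , old∈ , rep-inj , coverWith λ { refl _ → j , x~rj }
      ... | no fresh       = suc k , rep′ , rep′∈ , rep′-inj , cover′
        where
        rep′ : Fin (suc k) → A
        rep′ zero    = x
        rep′ (suc j) = rep j

        rep′∈ : ∀ j → rep′ j ∈ x ∷ L × P (rep′ j)
        rep′∈ zero    = here refl , px
        rep′∈ (suc j) = old∈ j

        rep′-inj : ∀ j j′ → rep′ j ~ rep′ j′ → j ≡ j′
        rep′-inj zero    zero     _ = refl
        rep′-inj zero    (suc j′) e = ⊥-elim (fresh (j′ , e))
        rep′-inj (suc j) zero     e = ⊥-elim (fresh (j , ~-sym e))
        rep′-inj (suc j) (suc j′) e = cong suc (rep-inj j j′ e)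

        cover′ : ∀ y → y ∈ x ∷ L × P y → ∃ λ j → y ~ rep′ j
        cover′ _ (here refl  , _)  = zero , ~-refl
        cover′ y (there y∈L , py) = let j , y~rj = cover y (y∈L , py) in suc j , y~rj

theorem1 : (α : Pattern) (n : ℕ) →
    ∃ λ k → HasNumClasses (IsLuk n) (AlphaEquiv α) k
          × HasNumClasses (IsMotz n) (AlphaEquiv α) k
theorem1 α n = k , luk , motz
  where
  enumerated : ∃ λ k → HasNumClasses (λ s → s ∈ motzkinWords n × IsMotz n s) (AlphaEquiv α) k
  enumerated = classesIn alphaEquiv-refl alphaEquiv-sym (isMotz? n) (alphaEquiv? α) (motzkinWords n)

  k = proj₁ enumerated

  motz : HasNumClasses (IsMotz n) (AlphaEquiv α) k
  motz = hasNumClasses-transfer {_~_ = AlphaEquiv α} alphaEquiv-trans proj₂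
    (λ {s} m → s , (∈-motzkinWords (proj₁ (proj₁ m)) (proj₂ m) , m) , alphaEquiv-refl)
    (proj₂ enumerated)

  luk : HasNumClasses (IsLuk n) (AlphaEquiv α) k
  luk = hasNumClasses-transfer {_~_ = AlphaEquiv α} alphaEquiv-trans proj₁ (motzkinTwin α) motz
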